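{- Let $q$ and $x$ be indeterminates, $[j]=\frac{1-q^j}{1-q}$, $[j]!=[1]\cdots[j]$ (with $[0]!=1$), and $\langle x\rangle_n=\prod_{j=0}^{n-1}(x-[j])$. Then for every $n\ge1$, $$\det\left(\langle x\rangle_{i+j}\right)_{i,j=0}^{n-1}=(-1)^{\binom{n}{2}}q^{2\binom{n}{3}}\prod_{j=0}^{n-1}[j]!\,\langle x\rangle_j.$$ -}

module Defs where

open import Level using (Level)
open import Algebra.Bundles using (CommutativeRing)
open import Data.Nat using (ℕ; zero; suc)
open import Data.Fin using (Fin; zero; suc; toℕ; punchIn)

-- All notions are defined over an arbitrary commutative ring R; the
-- polynomial identity in Z[q,x] is equivalent to its validity for all
-- q, x in all commutative rings (universal property of Z[q,x]).
module RingDefs {c ℓ : Level} (R : CommutativeRing c ℓ) where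
  open CommutativeRing R public using (Carrier; _≈_; _+_; _*_; -_; _-_; 0#; 1#)

  pow : Carrier → ℕ → Carrier
  pow a zero    = 1#
  pow a (suc k) = a * pow a k

  sumFin : (n : ℕ) → (Fin n → Carrier) → Carrier
  sumFin zero    f = 0#
  sumFin (suc n) f = f zero + sumFin n (λ i → f (suc i))

  prodTo : (n : ℕ) → (ℕ → Carrier) → Carrier
  prodTo zero    f = 1#
  prodTo (suc n) f = prodTo n f * f n

  -- q-integer [j] = (1 - q^j)/(1 - q) = 1 + q + ... + q^(j-1)
  qint : Carrier → ℕ → Carrier
  qint q j = prodSum j
    where
    prodSum : ℕ → Carrier
    prodSum zero    = 0#
    prodSum (suc k) = prodSum k + pow q k

  qfact : Carrier → ℕ → Carrier
  qfact q j = prodTo j (λ i → qint q (suc i))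

  qfall : Carrier → Carrier → ℕ → Carrier
  qfall q x n = prodTo n (λ j → x - qint q j)

  det : (n : ℕ) → (Fin n → Fin n → Carrier) → Carrier
  det zero    M = 1#
  det (suc n) M =
    sumFin (suc n) (λ j → pow (- 1#) (toℕ j) * (M zero j *
      det n (λ i k → M (suc i) (punchIn j k))))

-- Write F(m) = ∏_{j<m} (y − c[j]), so that ⟨x⟩_m is F for c = 1, y = x. Subtracting
-- (y − c[k]) times column k from column k + 1 of the Hankel matrix (F(i + j)) clears the
-- first row except for the entry 1, and since [i + k] = [k] + q^k [i] the entry in row i
-- becomes −c q^k [i] F(i + k). Moreover F(i + 1) = y F′(i), where F′ is F for the
-- parameters c q and y − c. Factoring [i + 1] y out of row i and −c q^k out of column k
-- therefore leaves the Hankel matrix of F′, one size smaller, and induction on the size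
-- gives the product formula; the constant collects the column factors ∏_{k<n} (−c q^k).
module Submission where

open import Defs
open import Algebra.Bundles using (CommutativeRing)
open import Data.Nat as ℕ using (ℕ; _≤_)
open import Data.Nat.Combinatorics using (_C_)
open import Data.Fin using (toℕ)

open import Level using (Level)
open import Data.Fin using (Fin; zero; suc; punchIn; punchOut; inject₁; fromℕ<)
import Data.Fin.Properties as Finₚ
import Data.Nat.Properties as ℕₚ
import Data.Nat.Combinatorics as ℕC
import Relation.Binary.PropositionalEquality as ≡
open ≡ using (_≡_; _≢_)
open import Relation.Nullary using (yes; no)
open import Data.Empty using (⊥-elim)
open import Data.Sum using (_⊎_; inj₁; inj₂)
open import Data.Product using (_×_; _,_)
open import Function using (_∘_; case_of_)

data Adjacent : ∀ {n} → Fin n → Fin n → Set where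
  adjacent-zero : ∀ {n} → Adjacent {ℕ.suc (ℕ.suc n)} zero (suc zero)
  adjacent-suc  : ∀ {n} {u v : Fin n} → Adjacent u v → Adjacent (suc u) (suc v)

Adjacent⇒toℕ-suc : ∀ {n} {u v : Fin n} → Adjacent u v → toℕ v ≡ ℕ.suc (toℕ u)
Adjacent⇒toℕ-suc adjacent-zero    = ≡.refl
Adjacent⇒toℕ-suc (adjacent-suc p) = ≡.cong ℕ.suc (Adjacent⇒toℕ-suc p)

Adjacent⇒≢ : ∀ {n} {u v : Fin n} → Adjacent u v → u ≢ v
Adjacent⇒≢ adjacent-zero    ()
Adjacent⇒≢ (adjacent-suc p) e = Adjacent⇒≢ p (Finₚ.suc-injective e)

inject₁-Adjacent-suc : ∀ {n} (j : Fin n) → Adjacent (inject₁ j) (suc j)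
inject₁-Adjacent-suc zero    = adjacent-zero
inject₁-Adjacent-suc (suc j) = adjacent-suc (inject₁-Adjacent-suc j)

Adjacent-punchOut : ∀ {n} {u v j : Fin (ℕ.suc n)} → Adjacent u v →
                    (j≢u : j ≢ u) (j≢v : j ≢ v) → Adjacent (punchOut j≢u) (punchOut j≢v)
Adjacent-punchOut {j = zero}        adjacent-zero j≢u j≢v = ⊥-elim (j≢u ≡.refl)
Adjacent-punchOut {j = suc zero}    adjacent-zero j≢u j≢v = ⊥-elim (j≢v ≡.refl)
Adjacent-punchOut {ℕ.suc (ℕ.suc n)} {j = suc (suc j)} adjacent-zero j≢u j≢v = adjacent-zero
Adjacent-punchOut {j = zero}        (adjacent-suc p) j≢u j≢v = p
Adjacent-punchOut {ℕ.suc n} {j = suc j} (adjacent-suc p) j≢u j≢v =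
  adjacent-suc (Adjacent-punchOut p (λ e → j≢u (≡.cong suc e)) (λ e → j≢v (≡.cong suc e)))

punchIn-Adjacent : ∀ {n} {u v : Fin (ℕ.suc n)} → Adjacent u v → ∀ k →
                   punchIn u k ≡ punchIn v k ⊎ (punchIn u k ≡ v × punchIn v k ≡ u)
punchIn-Adjacent adjacent-zero    zero    = inj₂ (≡.refl , ≡.refl)
punchIn-Adjacent adjacent-zero    (suc k) = inj₁ ≡.refl
punchIn-Adjacent (adjacent-suc p) zero    = inj₁ ≡.refl
punchIn-Adjacent (adjacent-suc p) (suc k) with punchIn-Adjacent p k
... | inj₁ e          = inj₁ (≡.cong suc e)
... | inj₂ (e₁ , e₂) = inj₂ (≡.cong suc e₁ , ≡.cong suc e₂)

module Hankel {r ℓ : Level} (R : CommutativeRing r ℓ) where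
  open RingDefs R
  open CommutativeRing R
    using ( setoid; +-cong; *-cong; -‿cong; +-assoc; +-identityˡ; +-identityʳ; -‿inverseʳ
          ; *-identityˡ; *-identityʳ; *-comm; *-assoc; zeroˡ; zeroʳ; distribˡ
          ; +-abelianGroup; ring; commutativeSemiring )
    renaming (refl to ≈-refl; sym to ≈-sym; trans to ≈-trans)
  open import Relation.Binary.Reasoning.Setoid setoid
  open import Algebra.Properties.Ring ring using (-1*x≈-x; -‿distribˡ-*)
  open import Algebra.Properties.AbelianGroup +-abelianGroup using (xyx⁻¹≈y; ⁻¹-∙-comm; ε⁻¹≈ε)
  open import Algebra.Solver.Ring.NaturalCoefficients.Default commutativeSemiring

  Matrix : ℕ → Set r
  Matrix n = Fin n → Fin n → Carrier

  Hankel : (ℕ → Carrier) → ∀ {n} → Matrix n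
  Hankel f i j = f (toℕ i ℕ.+ toℕ j)

  sign : ∀ {n} → Fin n → Carrier
  sign j = pow (- 1#) (toℕ j)

  minor : ∀ {n} → Matrix (ℕ.suc n) → Fin (ℕ.suc n) → Matrix n
  minor A j i k = A (suc i) (punchIn j k)

  *≈0 : ∀ x {y} → y ≈ 0# → x * y ≈ 0#
  *≈0 x y≈0 = ≈-trans (*-cong ≈-refl y≈0) (zeroʳ x)

  sumFin-cong : ∀ n {f g : Fin n → Carrier} → (∀ i → f i ≈ g i) → sumFin n f ≈ sumFin n g
  sumFin-cong ℕ.zero    f≈g = ≈-refl
  sumFin-cong (ℕ.suc n) f≈g = +-cong (f≈g zero) (sumFin-cong n (λ i → f≈g (suc i)))

  sumFin-zero : ∀ n {f : Fin n → Carrier} → (∀ i → f i ≈ 0#) → sumFin n f ≈ 0#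
  sumFin-zero ℕ.zero    f≈0 = ≈-refl
  sumFin-zero (ℕ.suc n) f≈0 =
    ≈-trans (+-cong (f≈0 zero) (sumFin-zero n (λ i → f≈0 (suc i)))) (+-identityˡ 0#)

  sumFin-+ : ∀ n (f g : Fin n → Carrier) →
             sumFin n (λ i → f i + g i) ≈ sumFin n f + sumFin n g
  sumFin-+ ℕ.zero    f g = ≈-sym (+-identityˡ 0#)
  sumFin-+ (ℕ.suc n) f g =
    ≈-trans (+-cong ≈-refl (sumFin-+ n (λ i → f (suc i)) (λ i → g (suc i))))
            (solve 4 (λ a b c d → (a :+ b) :+ (c :+ d) := (a :+ c) :+ (b :+ d)) ≈-refl _ _ _ _)

  sumFin-*ˡ : ∀ n a (f : Fin n → Carrier) → sumFin n (λ i → a * f i) ≈ a * sumFin n f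
  sumFin-*ˡ ℕ.zero    a f = ≈-sym (zeroʳ a)
  sumFin-*ˡ (ℕ.suc n) a f =
    ≈-trans (+-cong ≈-refl (sumFin-*ˡ n a (λ i → f (suc i)))) (≈-sym (distribˡ a _ _))

  det-cong : ∀ n {A B : Matrix n} → (∀ i j → A i j ≈ B i j) → det n A ≈ det n B
  det-cong ℕ.zero    A≈B = ≈-refl
  det-cong (ℕ.suc n) A≈B = sumFin-cong (ℕ.suc n) λ j →
    *-cong (≈-refl {sign j}) (*-cong (A≈B zero j) (det-cong n (λ i k → A≈B (suc i) (punchIn j k))))

  det-linear-column : ∀ n (t : Fin n) (a : Carrier) (A B B′ : Matrix n) →
    (∀ i k → k ≢ t → A i k ≈ B i k) → (∀ i k → k ≢ t → A i k ≈ B′ i k) →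
    (∀ i → A i t ≈ B i t + a * B′ i t) → det n A ≈ det n B + a * det n B′
  det-linear-column (ℕ.suc n) t a A B B′ A≈B A≈B′ A≈B+aB′ = begin
    det (ℕ.suc n) A                                          ≈⟨ sumFin-cong _ expand ⟩
    sumFin (ℕ.suc n) (λ j → term B j + a * term B′ j)        ≈⟨ sumFin-+ _ (term B) (λ j → a * term B′ j) ⟩
    det (ℕ.suc n) B + sumFin (ℕ.suc n) (λ j → a * term B′ j) ≈⟨ +-cong ≈-refl (sumFin-*ˡ _ a (term B′)) ⟩
    det (ℕ.suc n) B + a * det (ℕ.suc n) B′                   ∎
    where
    term : Matrix (ℕ.suc n) → Fin (ℕ.suc n) → Carrier
    term M j = sign j * (M zero j * det n (minor M j))

    expand : ∀ j → term A j ≈ term B j + a * term B′ j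
    expand j with j Finₚ.≟ t
    ... | yes ≡.refl = begin
      sign j * (A zero j * det n (minor A j))
        ≈⟨ *-cong ≈-refl (*-cong (A≈B+aB′ zero) (det-cong n minor-A≈B)) ⟩
      sign j * ((B zero j + a * B′ zero j) * det n (minor B j))
        ≈⟨ solve 5 (λ s b a x d → s :* ((b :+ a :* x) :* d) := s :* (b :* d) :+ a :* (s :* (x :* d)))
                   ≈-refl _ _ _ _ _ ⟩
      term B j + a * (sign j * (B′ zero j * det n (minor B j)))
        ≈⟨ +-cong ≈-refl (*-cong ≈-refl (*-cong ≈-refl (*-cong ≈-refl (det-cong n minor-B≈B′)))) ⟩
      term B j + a * term B′ j ∎
      where
      minor-A≈B : ∀ i k → minor A j i k ≈ minor B j i k
      minor-A≈B i k = A≈B (suc i) (punchIn j k) (Finₚ.punchInᵢ≢i j k)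
      minor-B≈B′ : ∀ i k → minor B j i k ≈ minor B′ j i k
      minor-B≈B′ i k = ≈-trans (≈-sym (minor-A≈B i k)) (A≈B′ (suc i) (punchIn j k) (Finₚ.punchInᵢ≢i j k))
    ... | no j≢t = begin
      sign j * (A zero j * det n (minor A j))
        ≈⟨ *-cong ≈-refl (*-cong ≈-refl minor-linear) ⟩
      sign j * (A zero j * (det n (minor B j) + a * det n (minor B′ j)))
        ≈⟨ solve 5 (λ s x a d e → s :* (x :* (d :+ a :* e)) := s :* (x :* d) :+ a :* (s :* (x :* e)))
                   ≈-refl _ _ _ _ _ ⟩
      sign j * (A zero j * det n (minor B j)) + a * (sign j * (A zero j * det n (minor B′ j)))
        ≈⟨ +-cong (*-cong ≈-refl (*-cong (A≈B zero j j≢t) ≈-refl))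
                  (*-cong ≈-refl (*-cong ≈-refl (*-cong (A≈B′ zero j j≢t) ≈-refl))) ⟩
      term B j + a * term B′ j ∎
      where
      t′ = punchOut j≢t
      punchIn-t′ : punchIn j t′ ≡ t
      punchIn-t′ = Finₚ.punchIn-punchOut j≢t
      off-t′ : ∀ k → k ≢ t′ → punchIn j k ≢ t
      off-t′ k k≢t′ e = k≢t′ (Finₚ.punchIn-injective j k t′ (≡.trans e (≡.sym punchIn-t′)))
      minor-linear = det-linear-column n t′ a (minor A j) (minor B j) (minor B′ j)
        (λ i k k≢t′ → A≈B (suc i) (punchIn j k) (off-t′ k k≢t′))
        (λ i k k≢t′ → A≈B′ (suc i) (punchIn j k) (off-t′ k k≢t′))
        (λ i → ≡.subst (λ z → A (suc i) z ≈ B (suc i) z + a * B′ (suc i) z)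
                       (≡.sym punchIn-t′) (A≈B+aB′ (suc i)))

  sumFin-adjacent : ∀ n {u v : Fin n} (f : Fin n → Carrier) → Adjacent u v →
    (∀ j → j ≢ u → j ≢ v → f j ≈ 0#) → f u + f v ≈ 0# → sumFin n f ≈ 0#
  sumFin-adjacent (ℕ.suc (ℕ.suc n)) f adjacent-zero f≈0 fu+fv≈0 = begin
    f zero + (f (suc zero) + sumFin n (λ i → f (suc (suc i))))
      ≈⟨ +-cong ≈-refl (+-cong ≈-refl (sumFin-zero n (λ i → f≈0 (suc (suc i)) (λ ()) (λ ())))) ⟩
    f zero + (f (suc zero) + 0#)
      ≈⟨ +-cong ≈-refl (+-identityʳ _) ⟩
    f zero + f (suc zero)
      ≈⟨ fu+fv≈0 ⟩
    0# ∎
  sumFin-adjacent (ℕ.suc n) f (adjacent-suc p) f≈0 fu+fv≈0 =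
    ≈-trans (+-cong (f≈0 zero (λ ()) (λ ())) (sumFin-adjacent n (λ i → f (suc i)) p f∘suc≈0 fu+fv≈0))
            (+-identityˡ 0#)
    where
    f∘suc≈0 : ∀ j → j ≢ _ → j ≢ _ → f (suc j) ≈ 0#
    f∘suc≈0 j j≢u j≢v =
      f≈0 (suc j) (λ e → j≢u (Finₚ.suc-injective e)) (λ e → j≢v (Finₚ.suc-injective e))

  -- Expanding along the first row, the terms at u and v cancel (equal minors, opposite
  -- signs) and every other minor again has two equal adjacent columns.
  det-equal-adjacent-columns : ∀ n {u v : Fin n} (A : Matrix n) → Adjacent u v →
                               (∀ i → A i u ≈ A i v) → det n A ≈ 0#
  det-equal-adjacent-columns (ℕ.suc n) {u} {v} A p Au≈Av =
    sumFin-adjacent (ℕ.suc n) term p other-terms cancel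
    where
    term : Fin (ℕ.suc n) → Carrier
    term j = sign j * (A zero j * det n (minor A j))

    other-terms : ∀ j → j ≢ u → j ≢ v → term j ≈ 0#
    other-terms j j≢u j≢v = *≈0 _ (*≈0 _ (det-equal-adjacent-columns n (minor A j)
      (Adjacent-punchOut p j≢u j≢v)
      (λ i → ≡.subst₂ (λ z w → A (suc i) z ≈ A (suc i) w)
               (≡.sym (Finₚ.punchIn-punchOut j≢u)) (≡.sym (Finₚ.punchIn-punchOut j≢v)) (Au≈Av (suc i)))))

    minor-u≈minor-v : ∀ i k → minor A u i k ≈ minor A v i k
    minor-u≈minor-v i k with punchIn-Adjacent p k
    ... | inj₁ e = ≡.subst (λ z → A (suc i) (punchIn u k) ≈ A (suc i) z) e ≈-refl
    ... | inj₂ (e₁ , e₂) =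
      ≡.subst₂ (λ z w → A (suc i) z ≈ A (suc i) w) (≡.sym e₁) (≡.sym e₂) (≈-sym (Au≈Av (suc i)))

    sign-v : sign v ≈ - sign u
    sign-v = ≡.subst (λ z → pow (- 1#) z ≈ - sign u) (≡.sym (Adjacent⇒toℕ-suc p)) (-1*x≈-x _)

    cancel : term u + term v ≈ 0#
    cancel = begin
      term u + sign v * (A zero v * det n (minor A v))
        ≈⟨ +-cong ≈-refl (*-cong sign-v (*-cong (≈-sym (Au≈Av zero)) (≈-sym (det-cong n minor-u≈minor-v)))) ⟩
      term u + (- sign u) * (A zero u * det n (minor A u))
        ≈⟨ +-cong ≈-refl (-‿distribˡ-* _ _) ⟨
      term u + - term u
        ≈⟨ -‿inverseʳ _ ⟩
      0# ∎

  replaceColumn : ∀ {n} → Matrix n → Fin n → Fin n → Matrix n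
  replaceColumn A t u i k with k Finₚ.≟ t
  ... | yes _ = A i u
  ... | no  _ = A i k

  replaceColumn-≡ : ∀ {n} (A : Matrix n) t u i → replaceColumn A t u i t ≈ A i u
  replaceColumn-≡ A t u i with t Finₚ.≟ t
  ... | yes _   = ≈-refl
  ... | no  t≢t = ⊥-elim (t≢t ≡.refl)

  replaceColumn-≢ : ∀ {n} (A : Matrix n) t u i k → k ≢ t → replaceColumn A t u i k ≈ A i k
  replaceColumn-≢ A t u i k k≢t with k Finₚ.≟ t
  ... | yes k≡t = ⊥-elim (k≢t k≡t)
  ... | no  _   = ≈-refl

  det-add-adjacent-column : ∀ n {u t : Fin n} (a : Carrier) (A B : Matrix n) → Adjacent u t →
    (∀ i k → k ≢ t → A i k ≈ B i k) → (∀ i → A i t ≈ B i t + a * B i u) → det n A ≈ det n B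
  det-add-adjacent-column n {u} {t} a A B p A≈B A≈B+aBu = begin
    det n A                  ≈⟨ det-linear-column n t a A B B′ A≈B A≈B′ A≈B+aB′ ⟩
    det n B + a * det n B′   ≈⟨ +-cong ≈-refl (*≈0 a (det-equal-adjacent-columns n B′ p B′u≈B′t)) ⟩
    det n B + 0#             ≈⟨ +-identityʳ _ ⟩
    det n B                  ∎
    where
    B′ = replaceColumn B t u
    A≈B′ : ∀ i k → k ≢ t → A i k ≈ B′ i k
    A≈B′ i k k≢t = ≈-trans (A≈B i k k≢t) (≈-sym (replaceColumn-≢ B t u i k k≢t))
    A≈B+aB′ : ∀ i → A i t ≈ B i t + a * B′ i t
    A≈B+aB′ i = ≈-trans (A≈B+aBu i) (+-cong ≈-refl (*-cong ≈-refl (≈-sym (replaceColumn-≡ B t u i))))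
    B′u≈B′t : ∀ i → B′ i u ≈ B′ i t
    B′u≈B′t i = ≈-trans (replaceColumn-≢ B t u i u (Adjacent⇒≢ p)) (≈-sym (replaceColumn-≡ B t u i))

  subtractPrevious : ∀ {m} → (Fin m → Carrier) → Matrix (ℕ.suc m) → Matrix (ℕ.suc m)
  subtractPrevious a M i zero    = M i zero
  subtractPrevious a M i (suc j) = M i (suc j) - a j * M i (inject₁ j)

  -- The column operations are performed from the last column to the first, so that each
  -- subtracts a column not modified yet: partialSweep r has modified exactly the columns
  -- j + 1 with r ≤ j.
  module ColumnSweep {m} (a : Fin m → Carrier) (M : Matrix (ℕ.suc m)) where
    partialSweep : ℕ → Matrix (ℕ.suc m)
    partialSweep r i zero = M i zero
    partialSweep r i (suc j) with r ℕ.≤? toℕ j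
    ... | yes _ = subtractPrevious a M i (suc j)
    ... | no  _ = M i (suc j)

    partialSweep-modified : ∀ r i j → r ≤ toℕ j → partialSweep r i (suc j) ≈ subtractPrevious a M i (suc j)
    partialSweep-modified r i j r≤j with r ℕ.≤? toℕ j
    ... | yes _   = ≈-refl
    ... | no  r≰j = ⊥-elim (r≰j r≤j)

    partialSweep-unmodified : ∀ r i k → toℕ k ≤ r → partialSweep r i k ≈ M i k
    partialSweep-unmodified r i zero    _ = ≈-refl
    partialSweep-unmodified r i (suc j) j<r with r ℕ.≤? toℕ j
    ... | yes r≤j = ⊥-elim (ℕₚ.<⇒≱ j<r r≤j)
    ... | no  _   = ≈-refl

    partialSweep-≢ : ∀ r i j → toℕ j ≢ r → partialSweep r i (suc j) ≈ partialSweep (ℕ.suc r) i (suc j)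
    partialSweep-≢ r i j j≢r = case r ℕ.≤? toℕ j of λ where
      (yes r≤j) → ≈-trans (partialSweep-modified r i j r≤j)
                          (≈-sym (partialSweep-modified (ℕ.suc r) i j (ℕₚ.≤∧≢⇒< r≤j (j≢r ∘ ≡.sym))))
      (no r≰j)  → ≈-trans (partialSweep-unmodified r i (suc j) (ℕₚ.≰⇒> r≰j))
                          (≈-sym (partialSweep-unmodified (ℕ.suc r) i (suc j) (ℕₚ.m≤n⇒m≤1+n (ℕₚ.≰⇒> r≰j))))

    partialSweep-beyond : ∀ r i k → m ≤ r → partialSweep r i k ≈ M i k
    partialSweep-beyond r i k m≤r =
      partialSweep-unmodified r i k (ℕₚ.≤-trans (ℕₚ.<⇒≤pred (Finₚ.toℕ<n k)) m≤r)

    partialSweep-step : ∀ r → det (ℕ.suc m) (partialSweep r) ≈ det (ℕ.suc m) (partialSweep (ℕ.suc r))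
    partialSweep-step r with r ℕ.<? m
    ... | no r≮m = det-cong (ℕ.suc m) λ i k →
      ≈-trans (partialSweep-beyond r i k m≤r)
              (≈-sym (partialSweep-beyond (ℕ.suc r) i k (ℕₚ.m≤n⇒m≤1+n m≤r)))
      where m≤r = ℕₚ.≮⇒≥ r≮m
    ... | yes r<m = det-add-adjacent-column (ℕ.suc m) (- a j) (partialSweep r) (partialSweep (ℕ.suc r))
                      (inject₁-Adjacent-suc j) off-column at-column
      where
      j = fromℕ< r<m
      j≡r : toℕ j ≡ r
      j≡r = Finₚ.toℕ-fromℕ< r<m

      toℕ≢r : ∀ {j′} → suc j′ ≢ suc j → toℕ j′ ≢ r
      toℕ≢r j′≢j e = j′≢j (≡.cong suc (Finₚ.toℕ-injective (≡.trans e (≡.sym j≡r))))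

      off-column : ∀ i k → k ≢ suc j → partialSweep r i k ≈ partialSweep (ℕ.suc r) i k
      off-column i zero     _      = ≈-refl
      off-column i (suc j′) j′≢j = partialSweep-≢ r i j′ (toℕ≢r j′≢j)

      at-column : ∀ i → partialSweep r i (suc j) ≈
                        partialSweep (ℕ.suc r) i (suc j) + (- a j) * partialSweep (ℕ.suc r) i (inject₁ j)
      at-column i = begin
        partialSweep r i (suc j)
          ≈⟨ partialSweep-modified r i j (ℕₚ.≤-reflexive (≡.sym j≡r)) ⟩
        M i (suc j) + - (a j * M i (inject₁ j))
          ≈⟨ +-cong (≈-sym (partialSweep-unmodified (ℕ.suc r) i (suc j) (ℕₚ.≤-reflexive (≡.cong ℕ.suc j≡r))))
                    (≈-trans (-‿distribˡ-* _ _)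
                             (*-cong ≈-refl (≈-sym (partialSweep-unmodified (ℕ.suc r) i (inject₁ j) inject₁-j≤r′)))) ⟩
        partialSweep (ℕ.suc r) i (suc j) + (- a j) * partialSweep (ℕ.suc r) i (inject₁ j) ∎
        where
        inject₁-j≤r′ : toℕ (inject₁ j) ≤ ℕ.suc r
        inject₁-j≤r′ = ℕₚ.m≤n⇒m≤1+n (ℕₚ.≤-reflexive (≡.trans (Finₚ.toℕ-inject₁ j) j≡r))

    det-partialSweep : ∀ k r → det (ℕ.suc m) (partialSweep r) ≈ det (ℕ.suc m) (partialSweep (k ℕ.+ r))
    det-partialSweep ℕ.zero    r = ≈-refl
    det-partialSweep (ℕ.suc k) r = ≈-trans (det-partialSweep k r) (partialSweep-step (k ℕ.+ r))

  det-subtractPrevious : ∀ m (a : Fin m → Carrier) (M : Matrix (ℕ.suc m)) →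
                         det (ℕ.suc m) (subtractPrevious a M) ≈ det (ℕ.suc m) M
  det-subtractPrevious m a M = begin
    det (ℕ.suc m) (subtractPrevious a M)   ≈⟨ det-cong _ sweep-0 ⟨
    det (ℕ.suc m) (partialSweep 0)         ≈⟨ det-partialSweep m 0 ⟩
    det (ℕ.suc m) (partialSweep (m ℕ.+ 0)) ≈⟨ det-cong _ (λ i k → partialSweep-beyond _ i k (ℕₚ.m≤m+n m 0)) ⟩
    det (ℕ.suc m) M                        ∎
    where
    open ColumnSweep a M
    sweep-0 : ∀ i k → partialSweep 0 i k ≈ subtractPrevious a M i k
    sweep-0 i zero    = ≈-refl
    sweep-0 i (suc j) = partialSweep-modified 0 i j ℕ.z≤n

  det-unit-first-row : ∀ n (A : Matrix (ℕ.suc n)) → A zero zero ≈ 1# → (∀ k → A zero (suc k) ≈ 0#) →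
                       det (ℕ.suc n) A ≈ det n (λ i k → A (suc i) (suc k))
  det-unit-first-row n A A₀₀≈1 A₀ₖ≈0 = begin
    1# * (A zero zero * det n (minor A zero)) + sumFin n (λ j → sign (suc j) * (A zero (suc j) * det n (minor A (suc j))))
      ≈⟨ +-cong (≈-trans (*-identityˡ _) (≈-trans (*-cong A₀₀≈1 ≈-refl) (*-identityˡ _)))
                (sumFin-zero n (λ j → *≈0 _ (≈-trans (*-cong (A₀ₖ≈0 j) ≈-refl) (zeroˡ _)))) ⟩
    det n (minor A zero) + 0#
      ≈⟨ +-identityʳ _ ⟩
    det n (λ i k → A (suc i) (suc k)) ∎

  prodFin : ∀ n → (Fin n → Carrier) → Carrier
  prodFin ℕ.zero    f = 1#
  prodFin (ℕ.suc n) f = f zero * prodFin n (λ i → f (suc i))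

  prodFin-punchIn : ∀ n (b : Fin (ℕ.suc n) → Carrier) (j : Fin (ℕ.suc n)) →
                    prodFin (ℕ.suc n) b ≈ b j * prodFin n (λ k → b (punchIn j k))
  prodFin-punchIn n         b zero    = ≈-refl
  prodFin-punchIn (ℕ.suc n) b (suc j) =
    ≈-trans (*-cong ≈-refl (prodFin-punchIn n (λ i → b (suc i)) j))
            (solve 3 (λ x y z → x :* (y :* z) := y :* (x :* z)) ≈-refl _ _ _)

  det-scale-rows-columns : ∀ n (a b : Fin n → Carrier) (N : Matrix n) →
    det n (λ i k → a i * b k * N i k) ≈ (prodFin n a * prodFin n b) * det n N
  det-scale-rows-columns ℕ.zero    a b N = ≈-sym (≈-trans (*-identityʳ _) (*-identityˡ _))
  det-scale-rows-columns (ℕ.suc n) a b N =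
    ≈-trans (sumFin-cong (ℕ.suc n) term) (sumFin-*ˡ (ℕ.suc n) _ (λ j → sign j * (N zero j * det n (minor N j))))
    where
    term : ∀ j → sign j * ((a zero * b j * N zero j) * det n (λ i k → a (suc i) * b (punchIn j k) * minor N j i k))
               ≈ (prodFin (ℕ.suc n) a * prodFin (ℕ.suc n) b) * (sign j * (N zero j * det n (minor N j)))
    term j = begin
      sign j * ((a zero * b j * N zero j) * det n (λ i k → a′ i * b′ k * minor N j i k))
        ≈⟨ *-cong ≈-refl (*-cong ≈-refl (det-scale-rows-columns n a′ b′ (minor N j))) ⟩
      sign j * ((a zero * b j * N zero j) * ((prodFin n a′ * prodFin n b′) * d))
        ≈⟨ solve 7 (λ s a₀ bⱼ n₀ pa pb d → s :* ((a₀ :* bⱼ :* n₀) :* ((pa :* pb) :* d))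
                                          := ((a₀ :* pa) :* (bⱼ :* pb)) :* (s :* (n₀ :* d)))
                   ≈-refl _ _ _ _ _ _ _ ⟩
      (prodFin (ℕ.suc n) a * (b j * prodFin n b′)) * (sign j * (N zero j * d))
        ≈⟨ *-cong (*-cong ≈-refl (prodFin-punchIn n b j)) ≈-refl ⟨
      (prodFin (ℕ.suc n) a * prodFin (ℕ.suc n) b) * (sign j * (N zero j * d)) ∎
      where
      a′ = λ i → a (suc i)
      b′ = λ k → b (punchIn j k)
      d  = det n (minor N j)

  pow-+ : ∀ a m n → pow a (m ℕ.+ n) ≈ pow a m * pow a n
  pow-+ a ℕ.zero    n = ≈-sym (*-identityˡ _)
  pow-+ a (ℕ.suc m) n = ≈-trans (*-cong ≈-refl (pow-+ a m n)) (≈-sym (*-assoc _ _ _))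

  pow-distrib-* : ∀ a b n → pow (a * b) n ≈ pow a n * pow b n
  pow-distrib-* a b ℕ.zero    = ≈-sym (*-identityˡ 1#)
  pow-distrib-* a b (ℕ.suc n) =
    ≈-trans (*-cong ≈-refl (pow-distrib-* a b n))
            (solve 4 (λ a b x y → (a :* b) :* (x :* y) := (a :* x) :* (b :* y)) ≈-refl _ _ _ _)

  pow-1# : ∀ n → pow 1# n ≈ 1#
  pow-1# ℕ.zero    = ≈-refl
  pow-1# (ℕ.suc n) = ≈-trans (*-identityˡ _) (pow-1# n)

  pow-2* : ∀ a n → pow a (2 ℕ.* n) ≈ pow a n * pow a n
  pow-2* a n rewrite ℕₚ.+-identityʳ n = pow-+ a n n

  prodTo-cong : ∀ n {f g : ℕ → Carrier} → (∀ i → f i ≈ g i) → prodTo n f ≈ prodTo n g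
  prodTo-cong ℕ.zero    f≈g = ≈-refl
  prodTo-cong (ℕ.suc n) f≈g = *-cong (prodTo-cong n f≈g) (f≈g n)

  prodTo-distrib-* : ∀ n (f g : ℕ → Carrier) → prodTo n (λ i → f i * g i) ≈ prodTo n f * prodTo n g
  prodTo-distrib-* ℕ.zero    f g = ≈-sym (*-identityˡ _)
  prodTo-distrib-* (ℕ.suc n) f g =
    ≈-trans (*-cong (prodTo-distrib-* n f g) ≈-refl)
            (solve 4 (λ a b x y → (a :* b) :* (x :* y) := (a :* x) :* (b :* y)) ≈-refl _ _ _ _)

  prodTo-suc : ∀ n (f : ℕ → Carrier) → prodTo (ℕ.suc n) f ≈ f 0 * prodTo n (λ i → f (ℕ.suc i))
  prodTo-suc ℕ.zero    f = *-comm _ _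
  prodTo-suc (ℕ.suc n) f = ≈-trans (*-cong (prodTo-suc n f) ≈-refl) (*-assoc _ _ _)

  prodFin-toℕ : ∀ n (f : ℕ → Carrier) → prodFin n (λ i → f (toℕ i)) ≈ prodTo n f
  prodFin-toℕ ℕ.zero    f = ≈-refl
  prodFin-toℕ (ℕ.suc n) f = ≈-trans (*-cong ≈-refl (prodFin-toℕ n (λ i → f (ℕ.suc i)))) (≈-sym (prodTo-suc n f))

  -‿distrib-+ : ∀ x y → - (x + y) ≈ - x + - y
  -‿distrib-+ x y = ≈-sym (⁻¹-∙-comm x y)

  sub-*-distrib-+ : ∀ y c w z → y - c * (w + z) ≈ (y - c * w) - c * z
  sub-*-distrib-+ y c w z = begin
    y + - (c * (w + z))         ≈⟨ +-cong ≈-refl (-‿cong (distribˡ c w z)) ⟩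
    y + - (c * w + c * z)       ≈⟨ +-cong ≈-refl (-‿distrib-+ _ _) ⟩
    y + (- (c * w) + - (c * z)) ≈⟨ +-assoc _ _ _ ⟨
    (y - c * w) - c * z         ∎

  module _ (q : Carrier) where
    qint-suc : ∀ m → qint q (ℕ.suc m) ≈ 1# + q * qint q m
    qint-suc ℕ.zero    = ≈-trans (+-identityˡ 1#) (≈-sym (≈-trans (+-cong ≈-refl (zeroʳ q)) (+-identityʳ 1#)))
    qint-suc (ℕ.suc m) =
      ≈-trans (+-cong (qint-suc m) ≈-refl)
              (solve 4 (λ o q w p → (o :+ q :* w) :+ q :* p := o :+ q :* (w :+ p)) ≈-refl 1# q (qint q m) (pow q m))

    qint-+ : ∀ m n → qint q (m ℕ.+ n) ≈ qint q m + pow q m * qint q n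
    qint-+ m ℕ.zero    rewrite ℕₚ.+-identityʳ m = ≈-sym (≈-trans (+-cong ≈-refl (zeroʳ _)) (+-identityʳ _))
    qint-+ m (ℕ.suc n) rewrite ℕₚ.+-suc m n =
      ≈-trans (+-cong (qint-+ m n) (pow-+ q m n))
              (solve 4 (λ a b x y → (a :+ b :* x) :+ b :* y := a :+ b :* (x :+ y)) ≈-refl _ _ _ _)

    scaledQFall : Carrier → Carrier → ℕ → Carrier
    scaledQFall c y m = prodTo m (λ j → y - c * qint q j)

    scaledQFall-suc : ∀ c y m → scaledQFall c y (ℕ.suc m) ≈ y * scaledQFall (c * q) (y - c) m
    scaledQFall-suc c y ℕ.zero = begin
      1# * (y - c * 0#) ≈⟨ *-identityˡ _ ⟩
      y - c * 0#        ≈⟨ +-cong ≈-refl (≈-trans (-‿cong (zeroʳ c)) ε⁻¹≈ε) ⟩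
      y + 0#            ≈⟨ +-identityʳ y ⟩
      y                 ≈⟨ *-identityʳ y ⟨
      y * 1#            ∎
    scaledQFall-suc c y (ℕ.suc m) = begin
      scaledQFall c y (ℕ.suc m) * (y - c * qint q (ℕ.suc m))
        ≈⟨ *-cong (scaledQFall-suc c y m) (+-cong ≈-refl (-‿cong (*-cong ≈-refl (qint-suc m)))) ⟩
      (y * scaledQFall (c * q) (y - c) m) * (y - c * (1# + q * qint q m))
        ≈⟨ *-cong ≈-refl (sub-*-distrib-+ y c 1# (q * qint q m)) ⟩
      (y * scaledQFall (c * q) (y - c) m) * ((y - c * 1#) - c * (q * qint q m))
        ≈⟨ *-cong ≈-refl (+-cong (+-cong ≈-refl (-‿cong (*-identityʳ c))) (-‿cong (≈-sym (*-assoc c q _)))) ⟩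
      (y * scaledQFall (c * q) (y - c) m) * ((y - c) - c * q * qint q m)
        ≈⟨ *-assoc _ _ _ ⟩
      y * scaledQFall (c * q) (y - c) (ℕ.suc m) ∎

    scaledQFall-difference : ∀ c y i k →
      scaledQFall c y (i ℕ.+ ℕ.suc k) - (y - c * qint q k) * scaledQFall c y (i ℕ.+ k)
        ≈ ((- c) * pow q k) * (qint q i * scaledQFall c y (i ℕ.+ k))
    scaledQFall-difference c y i k rewrite ℕₚ.+-suc i k = begin
      F * (y - c * qint q (i ℕ.+ k)) - a * F
        ≈⟨ +-cong (*-cong ≈-refl (+-cong ≈-refl (-‿cong (*-cong ≈-refl qint-i+k)))) ≈-refl ⟩
      F * (y - c * (qint q k + pow q k * qint q i)) - a * F
        ≈⟨ +-cong (*-cong ≈-refl (sub-*-distrib-+ y c _ _)) ≈-refl ⟩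
      F * (a - c * (pow q k * qint q i)) - a * F
        ≈⟨ +-cong (solve 3 (λ F a z → F :* (a :+ z) := a :* F :+ F :* z) ≈-refl F a _) ≈-refl ⟩
      (a * F + F * - (c * (pow q k * qint q i))) - a * F
        ≈⟨ xyx⁻¹≈y _ _ ⟩
      F * - (c * (pow q k * qint q i))
        ≈⟨ *-cong ≈-refl (-‿distribˡ-* _ _) ⟩
      F * ((- c) * (pow q k * qint q i))
        ≈⟨ solve 4 (λ F m p v → F :* (m :* (p :* v)) := (m :* p) :* (v :* F)) ≈-refl F (- c) _ _ ⟩
      ((- c) * pow q k) * (qint q i * F) ∎
      where
      F = scaledQFall c y (i ℕ.+ k)
      a = y - c * qint q k
      qint-i+k : qint q (i ℕ.+ k) ≈ qint q k + pow q k * qint q i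
      qint-i+k rewrite ℕₚ.+-comm i k = qint-+ k i

    columnMultiplier : Carrier → Carrier → ∀ {n} → Fin n → Carrier
    columnMultiplier c y k = y - c * qint q (toℕ k)

    subtractPrevious-Hankel : ∀ {n} c y (i : Fin (ℕ.suc n)) (k : Fin n) →
      subtractPrevious (columnMultiplier c y) (Hankel (scaledQFall c y)) i (suc k)
        ≈ ((- c) * pow q (toℕ k)) * (qint q (toℕ i) * scaledQFall c y (toℕ i ℕ.+ toℕ k))
    subtractPrevious-Hankel c y i k rewrite Finₚ.toℕ-inject₁ k = scaledQFall-difference c y (toℕ i) (toℕ k)

    hankelConstant : ℕ → Carrier → Carrier
    hankelConstant n c = (pow (- 1#) (n C 2) * pow c (n C 2)) * pow q (2 ℕ.* (n C 3))

    suc-C2 : ∀ n → ℕ.suc n C 2 ≡ n ℕ.+ n C 2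
    suc-C2 n = ≡.trans (≡.sym (ℕC.nCk+nC[k+1]≡[n+1]C[k+1] n 1)) (≡.cong (ℕ._+ n C 2) (ℕC.nC1≡n n))

    suc-C3 : ∀ n → ℕ.suc n C 3 ≡ n C 2 ℕ.+ n C 3
    suc-C3 n = ≡.sym (ℕC.nCk+nC[k+1]≡[n+1]C[k+1] n 2)

    prodTo-geometric : ∀ n c → prodTo n (λ k → (- c) * pow q k) ≈ (pow (- 1#) n * pow c n) * pow q (n C 2)
    prodTo-geometric ℕ.zero    c = ≈-sym (≈-trans (*-identityʳ _) (*-identityʳ _))
    prodTo-geometric (ℕ.suc n) c rewrite suc-C2 n = begin
      prodTo n (λ k → (- c) * pow q k) * ((- c) * pow q n)
        ≈⟨ *-cong (prodTo-geometric n c) (*-cong (≈-sym (-1*x≈-x c)) ≈-refl) ⟩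
      ((pow (- 1#) n * pow c n) * pow q (n C 2)) * (((- 1#) * c) * pow q n)
        ≈⟨ solve 6 (λ m c a b e f → ((a :* b) :* e) :* ((m :* c) :* f) := ((m :* a) :* (c :* b)) :* (f :* e))
                   ≈-refl (- 1#) c (pow (- 1#) n) (pow c n) (pow q (n C 2)) (pow q n) ⟩
      (pow (- 1#) (ℕ.suc n) * pow c (ℕ.suc n)) * (pow q n * pow q (n C 2))
        ≈⟨ *-cong ≈-refl (pow-+ q n (n C 2)) ⟨
      (pow (- 1#) (ℕ.suc n) * pow c (ℕ.suc n)) * pow q (n ℕ.+ n C 2) ∎

    hankelConstant-suc : ∀ n c →
      hankelConstant (ℕ.suc n) c ≈ prodTo n (λ k → (- c) * pow q k) * hankelConstant n (c * q)
    hankelConstant-suc n c rewrite suc-C2 n | suc-C3 n = begin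
      (pow (- 1#) (n ℕ.+ n C 2) * pow c (n ℕ.+ n C 2)) * pow q (2 ℕ.* (n C 2 ℕ.+ n C 3))
        ≈⟨ *-cong (*-cong (pow-+ (- 1#) n (n C 2)) (pow-+ c n (n C 2)))
                  (≈-trans (pow-2* q (n C 2 ℕ.+ n C 3))
                           (*-cong (pow-+ q (n C 2) (n C 3)) (pow-+ q (n C 2) (n C 3)))) ⟩
      ((A * F) * (B * G)) * ((E * H) * (E * H))
        ≈⟨ solve 6 (λ A B E F G H → ((A :* F) :* (B :* G)) :* ((E :* H) :* (E :* H))
                                   := ((A :* B) :* E) :* ((F :* (G :* E)) :* (H :* H)))
                   ≈-refl A B E F G H ⟩
      ((A * B) * E) * ((F * (G * E)) * (H * H))
        ≈⟨ *-cong (prodTo-geometric n c) (*-cong (*-cong ≈-refl (pow-distrib-* c q (n C 2))) (pow-2* q (n C 3))) ⟨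
      prodTo n (λ k → (- c) * pow q k) * hankelConstant n (c * q) ∎
      where
      A = pow (- 1#) n
      B = pow c n
      E = pow q (n C 2)
      F = pow (- 1#) (n C 2)
      G = pow c (n C 2)
      H = pow q (n C 3)

    prodTo-qfact-scaledQFall-suc : ∀ n c y →
      prodTo (ℕ.suc n) (λ j → qfact q j * scaledQFall c y j)
        ≈ prodTo n (λ j → qfact q j * scaledQFall (c * q) (y - c) j) * prodTo n (λ j → qint q (ℕ.suc j) * y)
    prodTo-qfact-scaledQFall-suc n c y = begin
      prodTo (ℕ.suc n) (λ j → qfact q j * scaledQFall c y j)
        ≈⟨ prodTo-suc n _ ⟩
      (1# * 1#) * prodTo n (λ j → qfact q (ℕ.suc j) * scaledQFall c y (ℕ.suc j))
        ≈⟨ ≈-trans (*-cong (*-identityˡ 1#) (prodTo-cong n shift)) (*-identityˡ _) ⟩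
      prodTo n (λ j → qfact q j * scaledQFall (c * q) (y - c) j * (qint q (ℕ.suc j) * y))
        ≈⟨ prodTo-distrib-* n _ _ ⟩
      prodTo n (λ j → qfact q j * scaledQFall (c * q) (y - c) j) * prodTo n (λ j → qint q (ℕ.suc j) * y) ∎
      where
      shift : ∀ j → qfact q (ℕ.suc j) * scaledQFall c y (ℕ.suc j)
                    ≈ qfact q j * scaledQFall (c * q) (y - c) j * (qint q (ℕ.suc j) * y)
      shift j = ≈-trans (*-cong ≈-refl (scaledQFall-suc c y j))
        (solve 4 (λ f v y p → (f :* v) :* (y :* p) := (f :* p) :* (v :* y)) ≈-refl (qfact q j) (qint q (ℕ.suc j)) y _)

    det-Hankel-scaledQFall : ∀ n c y →
      det n (Hankel (scaledQFall c y)) ≈ hankelConstant n c * prodTo n (λ j → qfact q j * scaledQFall c y j)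
    det-Hankel-scaledQFall ℕ.zero    c y = ≈-sym (≈-trans (*-identityʳ _) (≈-trans (*-identityʳ _) (*-identityʳ _)))
    det-Hankel-scaledQFall (ℕ.suc n) c y = begin
      det (ℕ.suc n) (Hankel F)
        ≈⟨ det-subtractPrevious n (columnMultiplier c y) (Hankel F) ⟨
      det (ℕ.suc n) (subtractPrevious (columnMultiplier c y) (Hankel F))
        ≈⟨ det-unit-first-row n (subtractPrevious (columnMultiplier c y) (Hankel F)) ≈-refl first-row ⟩
      det n (λ i k → subtractPrevious (columnMultiplier c y) (Hankel F) (suc i) (suc k))
        ≈⟨ det-cong n lower-rows ⟩
      det n (λ i k → rowFactor (toℕ i) * colFactor (toℕ k) * Hankel F′ i k)
        ≈⟨ det-scale-rows-columns n (rowFactor ∘ toℕ) (colFactor ∘ toℕ) (Hankel F′) ⟩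
      (prodFin n (rowFactor ∘ toℕ) * prodFin n (colFactor ∘ toℕ)) * det n (Hankel F′)
        ≈⟨ *-cong (*-cong (prodFin-toℕ n rowFactor) (prodFin-toℕ n colFactor)) (det-Hankel-scaledQFall n (c * q) (y - c)) ⟩
      (prodTo n rowFactor * prodTo n colFactor) * (hankelConstant n (c * q) * prodTo n (λ j → qfact q j * F′ j))
        ≈⟨ solve 4 (λ a b s g → (a :* b) :* (s :* g) := (b :* s) :* (g :* a)) ≈-refl _ _ _ _ ⟩
      (prodTo n colFactor * hankelConstant n (c * q)) * (prodTo n (λ j → qfact q j * F′ j) * prodTo n rowFactor)
        ≈⟨ *-cong (hankelConstant-suc n c) (prodTo-qfact-scaledQFall-suc n c y) ⟨
      hankelConstant (ℕ.suc n) c * prodTo (ℕ.suc n) (λ j → qfact q j * F j) ∎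
      where
      F  = scaledQFall c y
      F′ = scaledQFall (c * q) (y - c)
      rowFactor colFactor : ℕ → Carrier
      rowFactor i = qint q (ℕ.suc i) * y
      colFactor k = (- c) * pow q k

      first-row : ∀ k → subtractPrevious (columnMultiplier c y) (Hankel F) zero (suc k) ≈ 0#
      first-row k = ≈-trans (subtractPrevious-Hankel c y zero k) (*≈0 _ (zeroˡ _))

      lower-rows : ∀ i k → subtractPrevious (columnMultiplier c y) (Hankel F) (suc i) (suc k)
                           ≈ rowFactor (toℕ i) * colFactor (toℕ k) * Hankel F′ i k
      lower-rows i k = ≈-trans (subtractPrevious-Hankel c y (suc i) k)
        (≈-trans (*-cong ≈-refl (*-cong ≈-refl (scaledQFall-suc c y (toℕ i ℕ.+ toℕ k))))
                 (solve 4 (λ m v y p → m :* (v :* (y :* p)) := (v :* y) :* m :* p) ≈-refl _ _ y _))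

    det-Hankel-qfall : ∀ x n →
      det n (Hankel (qfall q x)) ≈ (pow (- 1#) (n C 2) * pow q (2 ℕ.* (n C 3))) * prodTo n (λ j → qfact q j * qfall q x j)
    det-Hankel-qfall x n = begin
      det n (Hankel (qfall q x))
        ≈⟨ det-cong n (λ i j → qfall≈scaledQFall (toℕ i ℕ.+ toℕ j)) ⟩
      det n (Hankel (scaledQFall 1# x))
        ≈⟨ det-Hankel-scaledQFall n 1# x ⟩
      hankelConstant n 1# * prodTo n (λ j → qfact q j * scaledQFall 1# x j)
        ≈⟨ *-cong (*-cong (≈-trans (*-cong ≈-refl (pow-1# (n C 2))) (*-identityʳ _)) ≈-refl)
                  (prodTo-cong n (λ j → *-cong ≈-refl (≈-sym (qfall≈scaledQFall j)))) ⟩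
      (pow (- 1#) (n C 2) * pow q (2 ℕ.* (n C 3))) * prodTo n (λ j → qfact q j * qfall q x j) ∎
      where
      qfall≈scaledQFall : ∀ m → qfall q x m ≈ scaledQFall 1# x m
      qfall≈scaledQFall m = prodTo-cong m (λ j → +-cong ≈-refl (-‿cong (≈-sym (*-identityˡ _))))

-- The identity also holds for n = 0, where both sides are 1.
mainTheorem8 : ∀ {c ℓ} (R : CommutativeRing c ℓ) (q x : CommutativeRing.Carrier R) (n : ℕ) → 1 ≤ n →
    let open RingDefs R
    in det n (λ i j → qfall q x (toℕ i ℕ.+ toℕ j))
       ≈ (pow (- 1#) (n C 2) * pow q (2 ℕ.* (n C 3))) * prodTo n (λ j → qfact q j * qfall q x j)
mainTheorem8 R q x n _ = Hankel.det-Hankel-qfall R q x n
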